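{- Let $\Phi$ be a read-once basic formula with root $r$, $\sigma$ an assignment to its variables, and $v$ a vertex of $\Phi$. Let $T$ be the set of special relatives of $v$. If $\sigma\notin\mathrm{SAT}(\Phi_u)$ for every $u\in T\cup\{v\}$, then $\sigma\notin\mathrm{SAT}(\Phi)$.
   Context: A read-once basic formula is a rooted directed tree whose leaves are labeled by distinct variables and whose internal vertices are labeled by $\wedge$ or $\vee$ gates of arity at least $2$ (equal to the number of children), with no $\wedge$ child of a $\wedge$ and no $\vee$ child of a $\vee$. For a vertex $u$, $\Phi_u$ is the subformula rooted at $u$, and $\mathrm{SAT}(\Phi_u)$ is the set of assignments under which $\Phi_u$ evaluates to $1$. The special relatives of $v$ are all vertices $u$ that are neither $v$ nor an ancestor of $v$, but are children of some ancestor $w$ of $v$ labeled by $\vee$. -}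

module Defs where

open import Data.Nat using (ℕ; zero; suc; _≤_)
open import Data.Bool using (Bool; true; false; _∧_; _∨_)
open import Data.List using (List; []; _∷_; _++_; length; [_])
open import Data.List.Relation.Unary.All using (All)
open import Data.List.Relation.Unary.Unique.Propositional using (Unique)
open import Data.Maybe using (Maybe; just; nothing)
open import Data.Product using (Σ; _×_; ∃; ∃-syntax)
open import Relation.Binary.PropositionalEquality using (_≡_; _≢_)
open import Relation.Nullary using (¬_)

data Gate : Set where
  AND OR : Gate

data Formula : Set where
  var  : ℕ → Formula
  gate : Gate → List Formula → Formula

Assignment : Set
Assignment = ℕ → Bool

mutual
  eval : Assignment → Formula → Bool
  eval σ (var x)       = σ x
  eval σ (gate AND cs) = evalAnd σ cs
  eval σ (gate OR cs)  = evalOr σ cs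

  evalAnd : Assignment → List Formula → Bool
  evalAnd σ []       = true
  evalAnd σ (c ∷ cs) = eval σ c ∧ evalAnd σ cs

  evalOr : Assignment → List Formula → Bool
  evalOr σ []       = false
  evalOr σ (c ∷ cs) = eval σ c ∨ evalOr σ cs

mutual
  vars : Formula → List ℕ
  vars (var x)     = x ∷ []
  vars (gate g cs) = varsList cs

  varsList : List Formula → List ℕ
  varsList []       = []
  varsList (c ∷ cs) = vars c ++ varsList cs

topGate : Formula → Maybe Gate
topGate (var x)    = nothing
topGate (gate g _) = just g

data Basic : Formula → Set where
  basic-var  : ∀ {x} → Basic (var x)
  basic-gate : ∀ {g cs} → 2 ≤ length cs →
               All (λ c → Basic c × (topGate c ≢ just g)) cs →
               Basic (gate g cs)

ReadOnceBasic : Formula → Set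
ReadOnceBasic Φ = Basic Φ × Unique (vars Φ)

-- Vertices are addressed by paths from the root (lists of child indices,
-- 0-based).  subAt Φ p is the subformula Φ_u rooted at the vertex u with path p,
-- or nothing if p is not a vertex.
mutual
  subAt : Formula → List ℕ → Maybe Formula
  subAt Φ []                = just Φ
  subAt (var x) (i ∷ p)     = nothing
  subAt (gate g cs) (i ∷ p) = subAtList cs i p

  subAtList : List Formula → ℕ → List ℕ → Maybe Formula
  subAtList []       i       p = nothing
  subAtList (c ∷ cs) zero    p = subAt c p
  subAtList (c ∷ cs) (suc i) p = subAtList cs i p

IsVertex : Formula → List ℕ → Set
IsVertex Φ p = ∃[ ψ ] (subAt Φ p ≡ just ψ)

IsAncestor : List ℕ → List ℕ → Set
IsAncestor w v = ∃[ i ] ∃[ rest ] (w ++ (i ∷ rest) ≡ v)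

IsSpecialRelative : Formula → List ℕ → List ℕ → Set
IsSpecialRelative Φ v u =
  IsVertex Φ u × (u ≢ v) × ¬ IsAncestor u v ×
  (∃[ w ] ∃[ i ] ∃[ cs ] (IsAncestor w v × subAt Φ w ≡ just (gate OR cs) × u ≡ w ++ [ i ]))

NotSatAt : Assignment → Formula → List ℕ → Set
NotSatAt σ Φ p = ∀ ψ → subAt Φ p ≡ just ψ → eval σ ψ ≡ false

module Submission where

-- Induct on the path v from the root to the falsified vertex.  If v is
-- the root there is nothing to prove.  Otherwise v = i ∷ p passes through the
-- i-th child c of the root; the hypotheses restrict to c (the vertex at p in c
-- is the same vertex, and special relatives of p in c are special relatives of
-- v in Φ), so by induction c is false under σ.  If the root is an ∧-gate, a
-- false child makes it false.  If the root is an ∨-gate, every other child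
-- [ j ] is itself a special relative of v (a child of the ∨-ancestor []), hence
-- false by hypothesis, so all children are false and so is the root.

open import Defs
open import Data.Nat using (ℕ; zero; suc)
open import Data.Nat.Properties using (_≟_)
open import Data.Bool using (false; _∧_; _∨_)
open import Data.Bool.Properties using (∧-zeroʳ)
open import Data.List using (List; []; _∷_; [_])
open import Data.List.Properties using (∷-injectiveˡ; ∷-injectiveʳ)
open import Data.Maybe using (just)
open import Data.Maybe.Properties using (just-injective)
open import Data.Product using (_×_; _,_; ∃)
open import Relation.Nullary using (yes; no)
open import Relation.Binary.PropositionalEquality
  using (_≡_; _≢_; refl; sym; trans; cong; cong₂; subst)

RelativesUnsat : Assignment → Formula → List ℕ → Set
RelativesUnsat σ Φ v = ∀ u → IsSpecialRelative Φ v u → NotSatAt σ Φ u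

descend : ∀ cs i p {ψ} → subAtList cs i p ≡ just ψ →
  ∃ λ c → subAtList cs i [] ≡ just c × subAt c p ≡ just ψ
descend []       i       p ()
descend (c ∷ cs) zero    p eq = c , refl , eq
descend (c ∷ cs) (suc i) p eq = descend cs i p eq

subAt-child : ∀ cs i q {c} → subAtList cs i [] ≡ just c → subAtList cs i q ≡ subAt c q
subAt-child []       i       q ()
subAt-child (c ∷ cs) zero    q refl = refl
subAt-child (c ∷ cs) (suc i) q eq   = subAt-child cs i q eq

evalAnd-false : ∀ σ cs i {c} → subAtList cs i [] ≡ just c → eval σ c ≡ false →
  evalAnd σ cs ≡ false
evalAnd-false σ []       i       ()   _
evalAnd-false σ (c ∷ cs) zero    refl c-false = cong (_∧ evalAnd σ cs) c-false
evalAnd-false σ (c ∷ cs) (suc i) eq   c-false =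
  trans (cong (eval σ c ∧_) (evalAnd-false σ cs i eq c-false)) (∧-zeroʳ (eval σ c))

evalOr-false : ∀ σ cs → (∀ j d → subAtList cs j [] ≡ just d → eval σ d ≡ false) →
  evalOr σ cs ≡ false
evalOr-false σ []       _   = refl
evalOr-false σ (c ∷ cs) all-false =
  cong₂ _∨_ (all-false zero c refl) (evalOr-false σ cs (λ j → all-false (suc j)))

lift-relative : ∀ g cs i {c} p u → subAtList cs i [] ≡ just c →
  IsSpecialRelative c p u → IsSpecialRelative (gate g cs) (i ∷ p) (i ∷ u)
lift-relative g cs i p u c-at
  ((ψ , u-vertex) , u≢p , u-not-anc , (w , k , ds , (a , r , w-anc) , w-or , u≡wk)) =
  (ψ , trans (subAt-child cs i u c-at) u-vertex) ,
  (λ e → u≢p (∷-injectiveʳ e)) ,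
  (λ { (a′ , r′ , e) → u-not-anc (a′ , r′ , ∷-injectiveʳ e) }) ,
  (i ∷ w , k , ds , (a , r , cong (i ∷_) w-anc) ,
   trans (subAt-child cs i w c-at) w-or , cong (i ∷_) u≡wk)

sibling-relative : ∀ cs i p j {d} → j ≢ i → subAtList cs j [] ≡ just d →
  IsSpecialRelative (gate OR cs) (i ∷ p) [ j ]
sibling-relative cs i p j j≢i d-at =
  (_ , d-at) ,
  (λ e → j≢i (∷-injectiveˡ e)) ,
  (λ { (_ , _ , e) → j≢i (∷-injectiveˡ e) }) ,
  ([] , j , cs , (i , p , refl) , refl , refl)

gate-false : ∀ σ g cs i p {c} → subAtList cs i [] ≡ just c → eval σ c ≡ false →
  RelativesUnsat σ (gate g cs) (i ∷ p) → eval σ (gate g cs) ≡ false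
gate-false σ AND cs i p c-at c-false _ = evalAnd-false σ cs i c-at c-false
gate-false σ OR  cs i p {c} c-at c-false relatives-unsat = evalOr-false σ cs child-false
  where
  child-false : ∀ j d → subAtList cs j [] ≡ just d → eval σ d ≡ false
  child-false j d d-at with j ≟ i
  ... | yes refl = subst (λ e → eval σ e ≡ false) (just-injective (trans (sym c-at) d-at)) c-false
  ... | no j≢i   = relatives-unsat [ j ] (sibling-relative cs i p j j≢i d-at) d d-at

unsat-by-relatives : ∀ Φ σ v → IsVertex Φ v → NotSatAt σ Φ v →
  RelativesUnsat σ Φ v → eval σ Φ ≡ false
unsat-by-relatives Φ           σ []      _         v-unsat _ = v-unsat Φ refl
unsat-by-relatives (var x)     σ (i ∷ p) (_ , ())
unsat-by-relatives (gate g cs) σ (i ∷ p) (ψ , v-at) v-unsat relatives-unsat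
  with descend cs i p v-at
... | c , c-at , p-at = gate-false σ g cs i p c-at c-false relatives-unsat
  where
  c-false : eval σ c ≡ false
  c-false = unsat-by-relatives c σ p (ψ , p-at)
    (λ ψ′ e → v-unsat ψ′ (trans (subAt-child cs i p c-at) e))
    (λ u rel ψ′ e → relatives-unsat (i ∷ u) (lift-relative g cs i p u c-at rel) ψ′
                      (trans (subAt-child cs i u c-at) e))

lemma5p4 : (Φ : Formula) → ReadOnceBasic Φ → (σ : Assignment) → (v : List ℕ) →
    IsVertex Φ v →
    NotSatAt σ Φ v →
    (∀ u → IsSpecialRelative Φ v u → NotSatAt σ Φ u) →
    eval σ Φ ≡ false
lemma5p4 Φ _ σ v = unsat-by-relatives Φ σ v
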